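{- Let $p,q$ be positive integers with $q\geqslant p>2$ and $p+q=n$. Then for every $n$-vertex tree $T$ with a $(p,q)$-bipartition, $\xi^{ee}(T)\leqslant\frac{5n-4}{6}$, with equality if and only if $T\cong P_2(p-1,q-1)$.
   Context: For a connected graph $G$, $\varepsilon_G(x)$ is the eccentricity of $x$, $d_G(x)$ its degree, and $\xi^{ee}(G)=\sum_{xy\in E_G}\left(\frac{1}{\varepsilon_G(x)}+\frac{1}{\varepsilon_G(y)}\right)=\sum_{x\in V_G}\frac{d_G(x)}{\varepsilon_G(x)}$. A tree has a $(p,q)$-bipartition ($p\leqslant q$) if its vertex set splits into colour classes of sizes $p$ and $q$ with every edge joining the two classes. $P_2(a,b)$ is the tree obtained from an edge $xy$ by attaching $a$ pendant vertices to $x$ and $b$ pendant vertices to $y$ (it has $a+b+2$ vertices). -}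

module Defs where

open import Data.Nat as ℕ using (ℕ; zero; suc; _+_; _≤_; _<_)
open import Data.Fin using (Fin; toℕ)
import Data.Fin as Fin
open import Data.Bool using (Bool; true; false)
open import Data.Integer using (+_)
open import Data.Rational as ℚ using (ℚ; 0ℚ)
open import Data.List using (List; []; _∷_; _++_; [_]; length)
open import Data.List.Relation.Unary.Linked using (Linked)
open import Data.List.Relation.Unary.Unique.Propositional using (Unique)
open import Data.Product using (Σ; ∃; _×_; _,_)
open import Relation.Nullary using (¬_; Dec; does)
open import Relation.Binary.PropositionalEquality using (_≡_; _≢_)
open import Function.Bundles using (_↔_; Inverse)

record Graph (n : ℕ) : Set₁ where
  field
    Adj   : Fin n → Fin n → Set
    adj?  : ∀ x y → Dec (Adj x y)
    sym   : ∀ {x y} → Adj x y → Adj y x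
    irrefl : ∀ {x} → ¬ Adj x x
open Graph public

count : ∀ {n} → (Fin n → Bool) → ℕ
count {zero}  f = 0
count {suc n} f with f Fin.zero
... | true  = suc (count (λ i → f (Fin.suc i)))
... | false = count (λ i → f (Fin.suc i))

degree : ∀ {n} (G : Graph n) → Fin n → ℕ
degree G x = count (λ y → does (adj? G x y))

data Walk {n} (G : Graph n) : Fin n → Fin n → ℕ → Set where
  nil  : ∀ {x} → Walk G x x 0
  cons : ∀ {x z y k} → Adj G x z → Walk G z y k → Walk G x y (suc k)

Connected : ∀ {n} → Graph n → Set
Connected G = ∀ x y → ∃ λ k → Walk G x y k

HasCycle : ∀ {n} → Graph n → Set
HasCycle {n} G = Σ (Fin n) λ v → Σ (List (Fin n)) λ rest →
  (3 ≤ length (v ∷ rest)) × Unique (v ∷ rest) × Linked (Adj G) ((v ∷ rest) ++ [ v ])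

IsTree : ∀ {n} → Graph n → Set
IsTree G = Connected G × ¬ HasCycle G

IsEccentricity : ∀ {n} → Graph n → Fin n → ℕ → Set
IsEccentricity {n} G x e =
  (∀ y → ∃ λ k → k ≤ e × Walk G x y k) ×
  (∃ λ y → ∀ k → Walk G x y k → e ≤ k)

HasBipartition : ∀ {n} → Graph n → ℕ → ℕ → Set
HasBipartition {n} G p q = Σ (Fin n → Bool) λ c →
  count (λ i → Data.Bool.not (c i)) ≡ p × count c ≡ q ×
  (∀ x y → Adj G x y → c x ≢ c y)
  where import Data.Bool

-- d / e as a rational (e is an eccentricity, which is ≥ 1 in a connected graph
-- with ≥ 2 vertices; the value 0 for e = 0 is never used)
_÷ℕ_ : ℕ → ℕ → ℚ
d ÷ℕ zero  = 0ℚ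
d ÷ℕ suc k = (+ d) ℚ./ suc k

sumℚ : ∀ {n} → (Fin n → ℚ) → ℚ
sumℚ {zero}  f = 0ℚ
sumℚ {suc n} f = f Fin.zero ℚ.+ sumℚ (λ i → f (Fin.suc i))

xiEE : ∀ {n} → Graph n → (Fin n → ℕ) → ℚ
xiEE G ε = sumℚ (λ x → degree G x ÷ℕ ε x)

record _≅_ {n m} (G : Graph n) (H : Graph m) : Set where
  field
    bij : Fin n ↔ Fin m
    pres : ∀ x y → (Adj G x y → Adj H (Inverse.to bij x) (Inverse.to bij y))
                 × (Adj H (Inverse.to bij x) (Inverse.to bij y) → Adj G x y)

-- P₂(a,b) on Fin (a+b+2): vertex 0 = x, vertex 1 = y, vertices 2..a+1 pendant at x,
-- vertices a+2..a+b+1 pendant at y.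
P2Edge : (a : ℕ) → ℕ → ℕ → Set
P2Edge a i j = (i ≡ 0 × j ≡ 1)
             ⊎ (i ≡ 0 × 2 ≤ j × j < 2 + a)
             ⊎ (i ≡ 1 × 2 + a ≤ j)
  where open import Data.Sum using (_⊎_)

open import Data.Sum using (_⊎_; inj₁; inj₂)
open import Data.Nat.Properties using (_≟_; _≤?_; _<?_)
open import Relation.Nullary using (yes; no)
open import Relation.Nullary.Decidable using (_×-dec_; _⊎-dec_)

P2Edge? : ∀ a i j → Dec (P2Edge a i j)
P2Edge? a i j = ((i ≟ 0) ×-dec (j ≟ 1))
  ⊎-dec (((i ≟ 0) ×-dec ((2 ≤? j) ×-dec (j <? 2 + a)))
  ⊎-dec ((i ≟ 1) ×-dec (2 + a ≤? j)))

P2Adj : (a b : ℕ) → Fin (suc (suc (a + b))) → Fin (suc (suc (a + b))) → Set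
P2Adj a b u v = P2Edge a (toℕ u) (toℕ v) ⊎ P2Edge a (toℕ v) (toℕ u)

private
  open import Data.Empty using (⊥)
  open import Relation.Binary.PropositionalEquality using (refl)

  P2Edge-irr : ∀ a i → ¬ P2Edge a i i
  P2Edge-irr a .0 (inj₁ (refl , ()))
  P2Edge-irr a .0 (inj₂ (inj₁ (refl , () , _)))
  P2Edge-irr a .1 (inj₂ (inj₂ (refl , ℕ.s≤s ())))

  swap⊎ : ∀ {A B : Set} → A ⊎ B → B ⊎ A
  swap⊎ (inj₁ x) = inj₂ x
  swap⊎ (inj₂ y) = inj₁ y

  irr : ∀ a b {u} → ¬ P2Adj a b u u
  irr a b {u} (inj₁ e) = P2Edge-irr a (toℕ u) e
  irr a b {u} (inj₂ e) = P2Edge-irr a (toℕ u) e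

P2 : (a b : ℕ) → Graph (suc (suc (a + b)))
P2 a b = record
  { Adj = P2Adj a b
  ; adj? = λ u v → P2Edge? a (toℕ u) (toℕ v) ⊎-dec P2Edge? a (toℕ v) (toℕ u)
  ; sym = swap⊎
  ; irrefl = irr a b
  }

module Submission where

-- Both colour classes have at least two vertices, so every eccentricity is at least 2
-- and a vertex of degree d and eccentricity e satisfies d/e ≤ (2d + [e ≤ 2]·d)/6, with
-- equality when e ≤ 3 (`weight`).  Summing, 6ξ ≤ 2S + E, where S = Σ deg = 2n - 2 by the
-- handshake lemma for trees (proved with breadth-first layers: every vertex but the root
-- has exactly one neighbour closer to the root) and E = Σ_{ε(z) ≤ 2} deg z.  Central
-- vertices (ε ≤ 2) are pairwise adjacent, since two of the same colour would lie on a
-- 4-cycle; so no vertex has two central neighbours (they would span a triangle), and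
-- counting E from the other end of each edge gives E ≤ n.  Hence 6ξ ≤ 5n - 4.
-- Equality forces every vertex to have a central neighbour, which produces a dominating
-- edge rx; a bipartite tree with a dominating edge is the double star P₂(p - 1, q - 1),
-- because every edge meets r or x and sorting the vertices by colour matches P₂.
-- Conversely P₂ has a dominating edge, around which every eccentricity is 2 or 3 and
-- every vertex has a central neighbour (E = n), so equality holds.

open import Defs hiding (sym)
open import Data.Nat as ℕ using (ℕ; zero; suc; _+_; _*_; _∸_; _≤_; _<_; z≤n; s≤s)
import Data.Nat.Properties as ℕP
open import Data.Nat.Tactic.RingSolver using (solve-∀)
open import Data.Fin as F using (Fin; toℕ)
import Data.Fin.Properties as FP
import Data.Bool.Properties as BP
open import Function using (case_of_; id)
open import Function.Construct.Composition using (_↔-∘_)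
open import Function.Bundles using (_↔_; _⇔_; Inverse; mk↔ₛ′; mk⇔)
open import Data.Fin.Permutation using (Permutation; _⟨$⟩ʳ_; _∘ₚ_; cast-id; transpose)
import Data.Fin.Permutation.Components as PC
open import Data.Bool using (Bool; true; false; not; _∧_; if_then_else_; T)
open import Data.Unit using (tt)
open import Data.Integer as ℤ using (+_)
import Data.Integer.Properties as ℤP
open import Data.Rational as ℚ using (ℚ; _/_; toℚᵘ)
import Data.Rational.Properties as ℚP
open import Data.Rational.Unnormalised as ℚᵘ using (mkℚᵘ; *≤*; *≡*)
import Data.Rational.Unnormalised.Properties as ℚᵘP
open import Data.Product using (Σ; _×_; _,_; proj₁; proj₂)
open import Data.Sum using (_⊎_; inj₁; inj₂)
import Data.Sum as Sum
open import Data.List using (List; []; _∷_; _++_; [_]; length)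
open import Data.List.Properties using (length-++)
open import Data.List.Relation.Unary.Linked using (Linked; [-]; _∷_)
open import Data.List.Relation.Unary.AllPairs using ([]; _∷_)
open import Data.List.Relation.Unary.All as All using (All; []; _∷_)
import Data.List.Relation.Unary.All.Properties as All
import Data.List.Relation.Unary.AllPairs.Properties as AllP
open import Data.List.Relation.Unary.Unique.Propositional using (Unique)
open import Data.Empty using (⊥; ⊥-elim)
open import Relation.Nullary using (¬_; Dec; yes; no; does)
open import Relation.Nullary.Reflects using (ofʸ; ofⁿ)
open import Relation.Nullary.Decidable using (dec-true; _×-dec_)
open import Relation.Binary.PropositionalEquality hiding ([_])

sumN : ∀ {n} → (Fin n → ℕ) → ℕ
sumN {zero}  f = 0
sumN {suc n} f = f F.zero + sumN (λ i → f (F.suc i))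

sumN-cong : ∀ {n} {f g : Fin n → ℕ} → (∀ i → f i ≡ g i) → sumN f ≡ sumN g
sumN-cong {zero}  h = refl
sumN-cong {suc n} h = cong₂ _+_ (h F.zero) (sumN-cong (λ i → h (F.suc i)))

sumN-const : ∀ {n} k → sumN {n} (λ _ → k) ≡ n * k
sumN-const {zero}  k = refl
sumN-const {suc n} k = cong (λ s → k + s) (sumN-const {n} k)

sumN-+ : ∀ {n} (f g : Fin n → ℕ) → sumN (λ i → f i + g i) ≡ sumN f + sumN g
sumN-+ {zero}  f g = refl
sumN-+ {suc n} f g =
  trans (cong (λ s → f F.zero + g F.zero + s) (sumN-+ (λ i → f (F.suc i)) (λ i → g (F.suc i))))
        (interchange (f F.zero) (g F.zero) _ _)
  where
  interchange : ∀ a b c d → a + b + (c + d) ≡ a + c + (b + d)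
  interchange = solve-∀

sumN-swap : ∀ {n m} (f : Fin n → Fin m → ℕ) →
  sumN (λ i → sumN (λ j → f i j)) ≡ sumN (λ j → sumN (λ i → f i j))
sumN-swap {zero}  {m} f = sym (trans (sumN-const {m} 0) (ℕP.*-zeroʳ m))
sumN-swap {suc n} f =
  trans (cong (λ s → sumN (f F.zero) + s) (sumN-swap (λ i → f (F.suc i))))
        (sym (sumN-+ (f F.zero) (λ j → sumN (λ i → f (F.suc i) j))))

sumN-≤1 : ∀ {n} (f : Fin n → ℕ) → (∀ i → f i ≤ 1) → sumN f ≤ n
sumN-≤1 {zero}  f h = z≤n
sumN-≤1 {suc n} f h = ℕP.+-mono-≤ (h F.zero) (sumN-≤1 (λ i → f (F.suc i)) (λ i → h (F.suc i)))

sumN-≥1 : ∀ {n} (f : Fin n → ℕ) → (∀ i → 1 ≤ f i) → n ≤ sumN f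
sumN-≥1 {zero}  f h = z≤n
sumN-≥1 {suc n} f h = ℕP.+-mono-≤ (h F.zero) (sumN-≥1 (λ i → f (F.suc i)) (λ i → h (F.suc i)))

sumN-full : ∀ {n} (f : Fin n → ℕ) → (∀ i → f i ≤ 1) → n ≤ sumN f → ∀ i → 1 ≤ f i
sumN-full {suc n} f h full F.zero =
  ℕP.+-cancelʳ-≤ n 1 (f F.zero)
    (ℕP.≤-trans full (ℕP.+-monoʳ-≤ (f F.zero) (sumN-≤1 (λ i → f (F.suc i)) (λ i → h (F.suc i)))))
sumN-full {suc n} f h full (F.suc i) =
  sumN-full (λ i → f (F.suc i)) (λ i → h (F.suc i))
    (ℕP.+-cancelˡ-≤ 1 n _ (ℕP.≤-trans full (ℕP.+-monoˡ-≤ _ (h F.zero)))) i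

indicator : Bool → ℕ
indicator true  = 1
indicator false = 0

count-sum : ∀ {n} (f : Fin n → Bool) → count f ≡ sumN (λ i → indicator (f i))
count-sum {zero}  f = refl
count-sum {suc n} f with f F.zero
... | true  = cong suc (count-sum (λ i → f (F.suc i)))
... | false = count-sum (λ i → f (F.suc i))

count-none : ∀ {n} (f : Fin n → Bool) → (∀ i → f i ≡ false) → count f ≡ 0
count-none {zero}  f h = refl
count-none {suc n} f h with f F.zero | h F.zero
... | false | _ = count-none (λ i → f (F.suc i)) (λ i → h (F.suc i))

count-all : ∀ {n} (f : Fin n → Bool) → (∀ i → f i ≡ true) → count f ≡ n
count-all {zero}  f h = refl
count-all {suc n} f h with f F.zero | h F.zero
... | true | _ = cong suc (count-all (λ i → f (F.suc i)) (λ i → h (F.suc i)))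

count-≥1 : ∀ {n} (f : Fin n → Bool) (a : Fin n) → f a ≡ true → 1 ≤ count f
count-≥1 {suc n} f a fa with f F.zero in e
count-≥1 {suc n} f a         fa | true  = s≤s z≤n
count-≥1 {suc n} f F.zero    fa | false = ⊥-elim (BP.not-¬ refl (trans (sym fa) e))
count-≥1 {suc n} f (F.suc a) fa | false = count-≥1 (λ i → f (F.suc i)) a fa

count-witness : ∀ {n} (f : Fin n → Bool) → 1 ≤ count f → Σ (Fin n) λ a → f a ≡ true
count-witness {suc n} f h with f F.zero in e
... | true  = F.zero , e
... | false = let (a , fa) = count-witness (λ i → f (F.suc i)) h in F.suc a , fa

count-witness-≢ : ∀ {n} (f : Fin n → Bool) → 2 ≤ count f → ∀ u →
  Σ (Fin n) λ a → a ≢ u × f a ≡ true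
count-witness-≢ {suc n} f h u with f F.zero in e
count-witness-≢ {suc n} f h F.zero | true =
  let (a , fa) = count-witness (λ i → f (F.suc i)) (ℕP.≤-pred h) in F.suc a , (λ ()) , fa
count-witness-≢ {suc n} f h (F.suc u) | true = F.zero , (λ ()) , e
count-witness-≢ {suc n} f h F.zero | false =
  let (a , fa) = count-witness (λ i → f (F.suc i)) (ℕP.≤-trans (s≤s z≤n) h) in F.suc a , (λ ()) , fa
count-witness-≢ {suc n} f h (F.suc u) | false =
  let (a , a≢u , fa) = count-witness-≢ (λ i → f (F.suc i)) h u
  in F.suc a , (λ eq → a≢u (FP.suc-injective eq)) , fa

count-≤1 : ∀ {n} (f : Fin n → Bool) → (∀ a b → f a ≡ true → f b ≡ true → a ≡ b) → count f ≤ 1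
count-≤1 {zero}  f h = z≤n
count-≤1 {suc n} f h with f F.zero in e
... | true  = ℕP.≤-reflexive (cong suc (count-none (λ i → f (F.suc i)) only-zero))
  where
  only-zero : ∀ i → f (F.suc i) ≡ false
  only-zero i with f (F.suc i) in ei
  ... | true  = case h F.zero (F.suc i) e ei of λ ()
  ... | false = refl
... | false = count-≤1 (λ i → f (F.suc i)) (λ a b fa fb → FP.suc-injective (h (F.suc a) (F.suc b) fa fb))

count-≢ : ∀ {n} (r : Fin n) → suc (count (λ z → not (does (z FP.≟ r)))) ≡ n
count-≢ F.zero    = cong suc (count-all _ (λ _ → refl))
count-≢ (F.suc r) = cong suc (count-≢ r)

frac : ℕ → ℕ → ℚ
frac a k = (+ a) / suc k

private
  toℚᵘ-frac : ∀ a k → toℚᵘ (frac a k) ℚᵘ.≃ mkℚᵘ (+ a) k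
  toℚᵘ-frac a k = ℚP.toℚᵘ-fromℚᵘ (mkℚᵘ (+ a) k)

  pos-* : ∀ a b → (+ a) ℤ.* (+ b) ≡ + (a * b)
  pos-* a b = sym (ℤP.pos-* a b)

frac-≤ : ∀ {a b k l} → a * suc l ≤ b * suc k → frac a k ℚ.≤ frac b l
frac-≤ {a} {b} {k} {l} h = ℚP.toℚᵘ-cancel-≤
  (ℚᵘP.≤-respʳ-≃ (ℚᵘP.≃-sym (toℚᵘ-frac b l)) (ℚᵘP.≤-respˡ-≃ (ℚᵘP.≃-sym (toℚᵘ-frac a k))
    (*≤* (subst₂ ℤ._≤_ (sym (pos-* a (suc l))) (sym (pos-* b (suc k))) (ℤ.+≤+ h)))))

frac-≤⁻ : ∀ {a b k l} → frac a k ℚ.≤ frac b l → a * suc l ≤ b * suc k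
frac-≤⁻ {a} {b} {k} {l} h with ℚᵘP.≤-respʳ-≃ (toℚᵘ-frac b l) (ℚᵘP.≤-respˡ-≃ (toℚᵘ-frac a k) (ℚP.toℚᵘ-mono-≤ h))
... | *≤* h′ = ℤP.drop‿+≤+ (subst₂ ℤ._≤_ (pos-* a (suc l)) (pos-* b (suc k)) h′)

frac-≡ : ∀ {a b k l} → a * suc l ≡ b * suc k → frac a k ≡ frac b l
frac-≡ {a} {b} {k} {l} h = ℚP.toℚᵘ-injective
  (ℚᵘP.≃-trans (toℚᵘ-frac a k) (ℚᵘP.≃-trans
    (*≡* (trans (pos-* a (suc l)) (trans (cong +_ h) (sym (pos-* b (suc k))))))
    (ℚᵘP.≃-sym (toℚᵘ-frac b l))))

frac-+ : ∀ a b k → frac a k ℚ.+ frac b k ≡ frac (a + b) k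
frac-+ a b k = ℚP.toℚᵘ-injective
  (ℚᵘP.≃-trans (ℚP.toℚᵘ-homo-+ (frac a k) (frac b k))
  (ℚᵘP.≃-trans (ℚᵘP.+-cong (toℚᵘ-frac a k) (toℚᵘ-frac b k))
  (ℚᵘP.≃-trans same-denominator (ℚᵘP.≃-sym (toℚᵘ-frac (a + b) k)))))
  where
  K : ℕ
  K = suc k
  same-denominator : (mkℚᵘ (+ a) k ℚᵘ.+ mkℚᵘ (+ b) k) ℚᵘ.≃ mkℚᵘ (+ (a + b)) k
  same-denominator = *≡* (begin
    ((+ a) ℤ.* (+ K) ℤ.+ (+ b) ℤ.* (+ K)) ℤ.* (+ K)
      ≡⟨ cong (ℤ._* (+ K)) (cong₂ ℤ._+_ (pos-* a K) (pos-* b K)) ⟩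
    (+ (a * K + b * K)) ℤ.* (+ K)
      ≡⟨ pos-* (a * K + b * K) K ⟩
    + ((a * K + b * K) * K)
      ≡⟨ cong +_ (distrib a b K) ⟩
    + ((a + b) * (K * K))
      ≡⟨ sym (pos-* (a + b) (K * K)) ⟩
    (+ (a + b)) ℤ.* (+ (K * K)) ∎)
    where
    open ≡-Reasoning
    distrib : ∀ a b K → (a * K + b * K) * K ≡ (a + b) * (K * K)
    distrib = solve-∀

sumℚ-mono : ∀ {m} {f g : Fin m → ℚ} → (∀ i → f i ℚ.≤ g i) → sumℚ f ℚ.≤ sumℚ g
sumℚ-mono {zero}  h = ℚP.≤-refl
sumℚ-mono {suc m} h = ℚP.+-mono-≤ (h F.zero) (sumℚ-mono (λ i → h (F.suc i)))

sumℚ-cong : ∀ {m} {f g : Fin m → ℚ} → (∀ i → f i ≡ g i) → sumℚ f ≡ sumℚ g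
sumℚ-cong {zero}  h = refl
sumℚ-cong {suc m} h = cong₂ ℚ._+_ (h F.zero) (sumℚ-cong (λ i → h (F.suc i)))

sumℚ-frac : ∀ {m} (h : Fin m → ℕ) k → sumℚ (λ i → frac (h i) k) ≡ frac (sumN h) k
sumℚ-frac {zero}  h k = frac-≡ {0} {0} {0} {k} refl
sumℚ-frac {suc m} h k =
  trans (cong (frac (h F.zero) k ℚ.+_) (sumℚ-frac (λ i → h (F.suc i)) k)) (frac-+ (h F.zero) _ k)

-- Weight of a vertex of degree d and eccentricity e: 2d, plus d once more
-- when e ≤ 2.  Six times d/e is at most this weight.
weight : ℕ → ℕ → ℕ
weight d e = 2 * d + (if e ℕ.≤ᵇ 2 then d else 0)

weight-exact : ∀ d e → 2 ≤ e → e ≤ 3 → d ÷ℕ e ≡ frac (weight d e) 5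
weight-exact d 2 _ _ = frac-≡ {d} {2 * d + d} {1} {5} (halves d)
  where
  halves : ∀ d → d * 6 ≡ (2 * d + d) * 2
  halves = solve-∀
weight-exact d 3 _ _ = frac-≡ {d} {2 * d + 0} {2} {5} (thirds d)
  where
  thirds : ∀ d → d * 6 ≡ (2 * d + 0) * 3
  thirds = solve-∀
weight-exact d 1 (s≤s ()) _
weight-exact d (suc (suc (suc (suc _)))) _ (s≤s (s≤s (s≤s ())))

weight-bound : ∀ d e → 2 ≤ e → d ÷ℕ e ℚ.≤ frac (weight d e) 5
weight-bound d (suc (suc (suc (suc k)))) _ =
  frac-≤ {d} {2 * d + 0} {suc (suc (suc k))} {5}
    (ℕP.≤-trans (ℕP.≤-reflexive (thirds d)) (ℕP.*-monoʳ-≤ (2 * d + 0) (s≤s (s≤s (s≤s z≤n)))))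
  where
  thirds : ∀ d → d * 6 ≡ (2 * d + 0) * 3
  thirds = solve-∀
weight-bound d 1 (s≤s ())
weight-bound d 2 h = ℚP.≤-reflexive (weight-exact d 2 h (s≤s (s≤s z≤n)))
weight-bound d 3 h = ℚP.≤-reflexive (weight-exact d 3 h ℕP.≤-refl)

private
  -- A tree has n ≥ 1 vertices, so 5n - 4 is a genuine difference.
  four≤5n : ∀ {S n} → S + 2 ≡ n + n → 4 ≤ 5 * n
  four≤5n {S} {zero}  h = case trans (ℕP.+-comm 2 S) h of λ ()
  four≤5n {S} {suc m} h = ℕP.≤-trans (ℕP.n≤1+n 4) (ℕP.*-monoʳ-≤ 5 (s≤s (z≤n {m})))

-- With S = 2n - 2 (the degree sum of a tree), 2S + E and 5n - 4 differ by E - n.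
budget : ∀ {S n} E → S + 2 ≡ n + n → S + S + E + n ≡ 5 * n ∸ 4 + E
budget {S} {n} E h = ℕP.+-cancelʳ-≡ 4 _ _ (begin
  S + S + E + n + 4         ≡⟨ regroup S E n ⟩
  (S + 2) + (S + 2) + E + n ≡⟨ cong (λ t → t + t + E + n) h ⟩
  (n + n) + (n + n) + E + n ≡⟨ five n E ⟩
  5 * n + E                 ≡⟨ cong (_+ E) (sym (ℕP.m∸n+n≡m (four≤5n {S} {n} h))) ⟩
  5 * n ∸ 4 + 4 + E         ≡⟨ swap (5 * n ∸ 4) E ⟩
  5 * n ∸ 4 + E + 4         ∎)
  where
  open ≡-Reasoning
  regroup : ∀ S E n → S + S + E + n + 4 ≡ (S + 2) + (S + 2) + E + n
  regroup = solve-∀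
  five : ∀ n E → (n + n) + (n + n) + E + n ≡ 5 * n + E
  five = solve-∀
  swap : ∀ a E → a + 4 + E ≡ a + E + 4
  swap = solve-∀

least : (P : ℕ → Set) → (∀ k → Dec (P k)) → ∀ m → P m →
  Σ ℕ λ k → P k × (∀ j → P j → k ≤ j)
least P P? m pm = search m 0 (λ _ ()) (subst P (sym (ℕP.+-identityʳ m)) pm)
  where
  -- search from i upwards, knowing that no j < i satisfies P and that P (fuel + i)
  search : ∀ fuel i → (∀ j → j < i → ¬ P j) → P (fuel + i) →
    Σ ℕ λ k → P k × (∀ j → P j → k ≤ j)
  search fuel i below pf with P? i
  ... | yes pi = i , pi , λ j pj → ℕP.≮⇒≥ (λ j<i → below j j<i pj)
  search zero       i below pf | no ¬pi = ⊥-elim (¬pi pf)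
  search (suc fuel) i below pf | no ¬pi =
    search fuel (suc i) below′ (subst P (sym (ℕP.+-suc fuel i)) pf)
    where
    below′ : ∀ j → j < suc i → ¬ P j
    below′ j j<1+i with ℕP.m≤n⇒m<n∨m≡n (ℕP.≤-pred j<1+i)
    ... | inj₁ j<i  = below j j<i
    ... | inj₂ refl = ¬pi

DominatingEdge : ∀ {n} → Graph n → Set
DominatingEdge {n} G = Σ (Fin n) λ r → Σ (Fin n) λ x →
  Adj G r x × (∀ z → Adj G r z ⊎ Adj G x z)

module Basics {n} (G : Graph n) where

  adj : Fin n → Fin n → Bool
  adj x y = does (adj? G x y)

  adj-true : ∀ {x y} → Adj G x y → adj x y ≡ true
  adj-true {x} {y} = dec-true (adj? G x y)

  adj-sound : ∀ {x y} → adj x y ≡ true → Adj G x y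
  adj-sound {x} {y} e with adj? G x y
  ... | yes a = a

  adj-≢ : ∀ {x y} → Adj G x y → x ≢ y
  adj-≢ a refl = Graph.irrefl G a

  walk0 : ∀ {x y} → Walk G x y 0 → x ≡ y
  walk0 nil = refl

  walk1 : ∀ {x y} → Walk G x y 1 → Adj G x y
  walk1 (cons a nil) = a

  walk? : ∀ k x y → Dec (Walk G x y k)
  walk? zero x y with x FP.≟ y
  ... | yes refl = yes nil
  ... | no x≢y   = no λ { nil → x≢y refl }
  walk? (suc k) x y with FP.any? (λ z → adj? G x z ×-dec walk? k z y)
  ... | yes (z , a , w) = yes (cons a w)
  ... | no ¬step        = no λ { (cons a w) → ¬step (_ , a , w) }

  square : ∀ {a b d e} → Adj G a b → Adj G b d → Adj G d e → Adj G e a →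
    a ≢ d → b ≢ e → HasCycle G
  square ab bd de ea a≢d b≢e =
    _ , (_ ∷ _ ∷ _ ∷ []) , s≤s (s≤s (s≤s z≤n)) ,
    ((adj-≢ ab ∷ a≢d ∷ (λ eq → adj-≢ ea (sym eq)) ∷ []) ∷ (adj-≢ bd ∷ b≢e ∷ []) ∷ (adj-≢ de ∷ []) ∷ [] ∷ []) ,
    (ab ∷ bd ∷ de ∷ ea ∷ [-])

  ecc-≤ : ∀ {v e m} → IsEccentricity G v e → (∀ y → Σ ℕ λ k → k ≤ m × Walk G v y k) → e ≤ m
  ecc-≤ (_ , far , far-ok) reach = let (k , k≤m , w) = reach far in ℕP.≤-trans (far-ok k w) k≤m

<ᵇ-complete : ∀ {m n} → m < n → (m ℕ.<ᵇ n) ≡ true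
<ᵇ-complete {m} {n} m<n with m ℕ.<ᵇ n | ℕP.<ᵇ-reflects-< m n
... | true  | _       = refl
... | false | ofⁿ m≮n = ⊥-elim (m≮n m<n)

-- k-fold negation: the colour reached after a walk of length k.
flips : ℕ → Bool → Bool
flips zero    b = b
flips (suc k) b = flips k (not b)

flips-injective : ∀ k {a b} → flips k a ≡ flips k b → a ≡ b
flips-injective zero    e = e
flips-injective (suc k) e = BP.not-injective (flips-injective k e)

module Colouring {n} (G : Graph n) (c : Fin n → Bool) (proper : ∀ x y → Adj G x y → c x ≢ c y) where
  open Basics G

  adj-flip : ∀ {x y} → Adj G x y → c y ≡ not (c x)
  adj-flip {x} {y} a with c x in ex | c y in ey
  ... | false | true  = refl
  ... | true  | false = refl
  ... | false | false = ⊥-elim (proper x y a (trans ex (sym ey)))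
  ... | true  | true  = ⊥-elim (proper x y a (trans ex (sym ey)))

  walk-parity : ∀ {x y k} → Walk G x y k → c y ≡ flips k (c x)
  walk-parity nil                      = refl
  walk-parity (cons {k = k} a w) = trans (walk-parity w) (cong (flips k) (adj-flip a))

  no-triangle : ∀ {a b d} → Adj G a b → Adj G b d → Adj G a d → ⊥
  no-triangle {a} {b} {d} ab bd ad =
    proper a d ad (sym (trans (adj-flip bd) (trans (cong not (adj-flip ab)) (BP.not-involutive (c a)))))

  short-walk-adj : ∀ {x y k} → Walk G x y k → k ≤ 2 → c x ≢ c y → Adj G x y
  short-walk-adj (cons a nil)          _ _   = a
  short-walk-adj nil                   _ c≢c = ⊥-elim (c≢c refl)
  short-walk-adj {x} w@(cons _ (cons _ nil)) _ c≢c =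
    ⊥-elim (c≢c (sym (trans (walk-parity w) (BP.not-involutive (c x)))))
  short-walk-adj (cons _ (cons _ (cons _ _))) (s≤s (s≤s ())) _

linked-wrap : ∀ {A : Set} {R : A → A → Set} {a x y b} mid →
  R a x → Linked R (x ∷ mid ++ [ y ]) → R y b → Linked R (a ∷ (x ∷ mid ++ [ y ]) ++ [ b ])
linked-wrap {R = R} {y = y} {b = b} mid rax l ryb = rax ∷ go mid l
  where
  go : ∀ {x} mid → Linked R (x ∷ mid ++ [ y ]) → Linked R ((x ∷ mid ++ [ y ]) ++ [ b ])
  go []      (rxy ∷ [-]) = rxy ∷ ryb ∷ [-]
  go (m ∷ mid) (rxm ∷ l) = rxm ∷ go mid l

module BreadthFirst {n} (G : Graph n) (c : Fin n → Bool) (proper : ∀ x y → Adj G x y → c x ≢ c y)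
                    (conn : Connected G) (r : Fin n) where
  open Basics G
  open Colouring G c proper

  private
    shortest : ∀ y → Σ ℕ λ k → Walk G y r k × (∀ j → Walk G y r j → k ≤ j)
    shortest y = least (λ k → Walk G y r k) (λ k → walk? k y r) (proj₁ (conn y r)) (proj₂ (conn y r))

  dist : Fin n → ℕ
  dist y = proj₁ (shortest y)

  dist-walk : ∀ y → Walk G y r (dist y)
  dist-walk y = proj₁ (proj₂ (shortest y))

  dist-min : ∀ y {j} → Walk G y r j → dist y ≤ j
  dist-min y w = proj₂ (proj₂ (shortest y)) _ w

  dist-root : dist r ≡ 0
  dist-root = ℕP.n≤0⇒n≡0 (dist-min r nil)

  dist-zero : ∀ {y} → dist y ≡ 0 → y ≡ r
  dist-zero {y} e = walk0 (subst (Walk G y r) e (dist-walk y))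

  dist-adj : ∀ {x y} → Adj G x y → dist x ≤ suc (dist y)
  dist-adj {x} {y} a = dist-min x (cons a (dist-walk y))

  -- Adjacent vertices have different colours, hence distances of different parity.
  dist-adj-≢ : ∀ {x y} → Adj G x y → dist x ≢ dist y
  dist-adj-≢ {x} {y} a e = proper x y a (flips-injective (dist x)
    (trans (sym (walk-parity (dist-walk x))) (trans (walk-parity (dist-walk y)) (cong (λ d → flips d (c y)) (sym e)))))

  parent : ∀ y {k} → dist y ≡ suc k → Σ (Fin n) λ z → Adj G y z × dist z ≡ k
  parent y {k} e with subst (Walk G y r) e (dist-walk y)
  ... | cons {z = z} a w = z , a , ℕP.≤-antisym (dist-min z w) (ℕP.≤-pred (subst (_≤ suc (dist z)) e (dist-adj a)))

  record BallPath (k : ℕ) (u₁ u₂ : Fin n) : Set where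
    field
      inner  : List (Fin n)
      linked : Linked (Adj G) (u₁ ∷ inner ++ [ u₂ ])
      unique : Unique (u₁ ∷ inner ++ [ u₂ ])
      inBall : All (λ z → dist z ≤ k) (u₁ ∷ inner ++ [ u₂ ])

  private
    farther-≢ : ∀ {k y z} → dist y ≡ suc k → dist z ≤ k → z ≢ y
    farther-≢ ey dz refl = ℕP.<-irrefl ey (s≤s dz)

    below-≢ : ∀ {k y z} → dist y ≡ suc k → dist z ≤ k → y ≢ z
    below-≢ ey dz e = farther-≢ ey dz (sym e)

  -- Two distinct vertices at the same distance k are joined inside the ball of radius k
  -- (walk both towards the root until the two routes meet).
  ball-path : ∀ k u₁ u₂ → dist u₁ ≡ k → dist u₂ ≡ k → u₁ ≢ u₂ → BallPath k u₁ u₂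
  ball-path zero u₁ u₂ e₁ e₂ u₁≢u₂ = ⊥-elim (u₁≢u₂ (trans (dist-zero e₁) (sym (dist-zero e₂))))
  ball-path (suc k) u₁ u₂ e₁ e₂ u₁≢u₂ with parent u₁ e₁ | parent u₂ e₂
  ... | (w₁ , a₁ , d₁) | (w₂ , a₂ , d₂) with w₁ FP.≟ w₂
  ... | yes refl = record
    { inner  = [ w₁ ]
    ; linked = a₁ ∷ Graph.sym G a₂ ∷ [-]
    ; unique = (below-≢ e₁ (ℕP.≤-reflexive d₁) ∷ u₁≢u₂ ∷ []) ∷ (farther-≢ e₂ (ℕP.≤-reflexive d₁) ∷ []) ∷ [] ∷ []
    ; inBall = ℕP.≤-reflexive e₁ ∷ ℕP.m≤n⇒m≤1+n (ℕP.≤-reflexive d₁) ∷ ℕP.≤-reflexive e₂ ∷ []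
    }
  ... | no w₁≢w₂ = record
    { inner  = middle
    ; linked = linked-wrap inner a₁ linked (Graph.sym G a₂)
    ; unique = All.++⁺ u₁-fresh (u₁≢u₂ ∷ []) ∷ AllP.++⁺ unique ([] ∷ []) (All.map (_∷ []) u₂-fresh)
    ; inBall = ℕP.≤-reflexive e₁ ∷ All.++⁺ (All.map ℕP.m≤n⇒m≤1+n inBall) (ℕP.≤-reflexive e₂ ∷ [])
    }
    where
    open BallPath (ball-path k w₁ w₂ d₁ d₂ w₁≢w₂)
    middle : List (Fin n)
    middle = w₁ ∷ inner ++ [ w₂ ]
    u₁-fresh : All (u₁ ≢_) middle
    u₁-fresh = All.map (below-≢ e₁) inBall
    u₂-fresh : All (_≢ u₂) middle
    u₂-fresh = All.map (farther-≢ e₂) inBall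

  two-parents-cycle : ∀ {v u₁ u₂} → Adj G v u₁ → Adj G v u₂ → dist u₁ < dist v → dist u₂ < dist v →
    u₁ ≢ u₂ → HasCycle G
  two-parents-cycle {v} {u₁} {u₂} a₁ a₂ l₁ l₂ u₁≢u₂ =
    v , (u₁ ∷ inner ++ [ u₂ ]) ,
    s≤s (s≤s (subst (1 ≤_) (sym (length-++ inner)) (ℕP.m≤n+m 1 (length inner)))) ,
    All.map v-fresh inBall ∷ unique ,
    linked-wrap inner a₁ linked (Graph.sym G a₂)
    where
    same-layer : dist u₂ ≡ dist u₁
    same-layer = ℕP.suc-injective (trans (ℕP.≤-antisym l₂ (dist-adj a₂)) (ℕP.≤-antisym (dist-adj a₁) l₁))
    open BallPath (ball-path (dist u₁) u₁ u₂ refl same-layer u₁≢u₂)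
    v-fresh : ∀ {z} → dist z ≤ dist u₁ → v ≢ z
    v-fresh dz refl = ℕP.<-irrefl refl (ℕP.≤-<-trans dz l₁)

  closer : Fin n → Fin n → Bool
  closer z w = adj z w ∧ (dist w ℕ.<ᵇ dist z)

  edge-orientation : ∀ z w → indicator (adj z w) ≡ indicator (closer z w) + indicator (closer w z)
  edge-orientation z w with adj? G z w | adj? G w z
  ... | no _   | no _   = refl
  ... | yes a  | no ¬a  = ⊥-elim (¬a (Graph.sym G a))
  ... | no ¬a  | yes a  = ⊥-elim (¬a (Graph.sym G a))
  ... | yes a  | yes _ with dist w ℕ.<ᵇ dist z | ℕP.<ᵇ-reflects-< (dist w) (dist z)
                         | dist z ℕ.<ᵇ dist w | ℕP.<ᵇ-reflects-< (dist z) (dist w)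
  ...   | true  | ofʸ w<z | true  | ofʸ z<w = ⊥-elim (ℕP.<-asym w<z z<w)
  ...   | true  | _       | false | _       = refl
  ...   | false | _       | true  | _       = refl
  ...   | false | ofⁿ w≮z | false | ofⁿ z≮w = ⊥-elim (dist-adj-≢ a (ℕP.≤-antisym (ℕP.≮⇒≥ w≮z) (ℕP.≮⇒≥ z≮w)))

  parents : Fin n → ℕ
  parents z = count (closer z)

  -- Double counting: summing the degrees counts every edge once from each end.
  degree-sum-parents : sumN (degree G) ≡ sumN parents + sumN parents
  degree-sum-parents = begin
    sumN (degree G)
      ≡⟨ sumN-cong (λ z → trans (count-sum (adj z)) (sumN-cong (edge-orientation z))) ⟩
    sumN (λ z → sumN (λ w → indicator (closer z w) + indicator (closer w z)))
      ≡⟨ sumN-cong (λ z → sumN-+ (λ w → indicator (closer z w)) (λ w → indicator (closer w z))) ⟩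
    sumN (λ z → sumN (λ w → indicator (closer z w)) + sumN (λ w → indicator (closer w z)))
      ≡⟨ sumN-+ (λ z → sumN (λ w → indicator (closer z w))) (λ z → sumN (λ w → indicator (closer w z))) ⟩
    sumN (λ z → sumN (λ w → indicator (closer z w))) + sumN (λ z → sumN (λ w → indicator (closer w z)))
      ≡⟨ cong (λ t → sumN (λ z → sumN (λ w → indicator (closer z w))) + t)
              (sumN-swap (λ z w → indicator (closer w z))) ⟩
    sumN (λ z → sumN (λ w → indicator (closer z w))) + sumN (λ w → sumN (λ z → indicator (closer w z)))
      ≡⟨ sym (cong₂ _+_ (sumN-cong (λ z → count-sum (closer z))) (sumN-cong (λ w → count-sum (closer w)))) ⟩
    sumN parents + sumN parents ∎
    where open ≡-Reasoning

  parents-root : parents r ≡ 0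
  parents-root = count-none (closer r) none
    where
    none : ∀ w → closer r w ≡ false
    none w with dist w ℕ.<ᵇ dist r | ℕP.<ᵇ-reflects-< (dist w) (dist r)
    ... | true  | ofʸ w<r = ⊥-elim (ℕP.n≮0 (subst (dist w <_) dist-root w<r))
    ... | false | _       = BP.∧-zeroʳ (adj r w)

  parents-nonroot : ¬ HasCycle G → ∀ {z k} → dist z ≡ suc k → parents z ≡ 1
  parents-nonroot acyc {z} dz =
    ℕP.≤-antisym (count-≤1 (closer z) unique-parent) (count-≥1 (closer z) w closer-w)
    where
    w : Fin n
    w = proj₁ (parent z dz)
    closer-w : closer z w ≡ true
    closer-w = let (_ , a , dw) = parent z dz in
      cong₂ _∧_ (adj-true a) (<ᵇ-complete (subst₂ _<_ (sym dw) (sym dz) ℕP.≤-refl))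
    closer-sound : ∀ {u} → closer z u ≡ true → Adj G z u × dist u < dist z
    closer-sound {u} e with adj? G z u | dist u ℕ.<ᵇ dist z | ℕP.<ᵇ-reflects-< (dist u) (dist z)
    ... | yes a | true  | ofʸ l = a , l
    ... | yes _ | false | _     = case e of λ ()
    ... | no _  | _     | _     = case e of λ ()
    unique-parent : ∀ u₁ u₂ → closer z u₁ ≡ true → closer z u₂ ≡ true → u₁ ≡ u₂
    unique-parent u₁ u₂ e₁ e₂ with u₁ FP.≟ u₂
    ... | yes eq   = eq
    ... | no u₁≢u₂ = let (a₁ , l₁) = closer-sound e₁ ; (a₂ , l₂) = closer-sound e₂ in
                     ⊥-elim (acyc (two-parents-cycle a₁ a₂ l₁ l₂ u₁≢u₂))

  parents-tree : ¬ HasCycle G → ∀ z → parents z ≡ indicator (not (does (z FP.≟ r)))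
  parents-tree acyc z = by-cases (z FP.≟ r)
    where
    by-cases : (d : Dec (z ≡ r)) → parents z ≡ indicator (not (does d))
    by-cases (yes z≡r) = subst (λ y → parents y ≡ 0) (sym z≡r) parents-root
    by-cases (no z≢r) = by-distance (dist z) refl
      where
      by-distance : ∀ d → dist z ≡ d → parents z ≡ 1
      by-distance zero    dz = ⊥-elim (z≢r (dist-zero dz))
      by-distance (suc k) dz = parents-nonroot acyc dz

tree-degree-sum : ∀ {n} (G : Graph n) (c : Fin n → Bool) → (∀ x y → Adj G x y → c x ≢ c y) →
  IsTree G → Fin n → sumN (degree G) + 2 ≡ n + n
tree-degree-sum {n} G c proper (conn , acyc) r = begin
  sumN (degree G) + 2                        ≡⟨ cong (_+ 2) degree-sum-parents ⟩
  sumN parents + sumN parents + 2            ≡⟨ regroup (sumN parents) ⟩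
  suc (sumN parents) + suc (sumN parents)    ≡⟨ cong (λ t → t + t) non-root ⟩
  n + n                                      ∎
  where
  open BreadthFirst G c proper conn r
  open ≡-Reasoning
  regroup : ∀ s → s + s + 2 ≡ suc s + suc s
  regroup = solve-∀
  non-root : suc (sumN parents) ≡ n
  non-root = trans (cong suc (trans (sumN-cong (parents-tree acyc)) (sym (count-sum (λ z → not (does (z FP.≟ r)))))))
                   (count-≢ r)

module Eccentricities {n} (G : Graph n) (c : Fin n → Bool) (proper : ∀ x y → Adj G x y → c x ≢ c y)
                      (classes : ∀ b u → Σ (Fin n) λ a → a ≢ u × c a ≡ b)
                      (ε : Fin n → ℕ) (ecc : ∀ x → IsEccentricity G x (ε x)) where
  open Basics G
  open Colouring G c proper

  reach : ∀ z y → Σ ℕ λ k → k ≤ ε z × Walk G z y k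
  reach z y = proj₁ (ecc z) y

  -- Another vertex of the same colour is at distance at least 2.
  ecc-≥2 : ∀ z → 2 ≤ ε z
  ecc-≥2 z with classes (c z) z
  ... | (a , a≢z , ca) with reach z a
  ... | (k , k≤ε , w) = ℕP.≮⇒≥ λ ε<2 → too-short k (ℕP.≤-trans k≤ε (ℕP.≤-pred ε<2)) w
    where
    too-short : ∀ k → k ≤ 1 → Walk G z a k → ⊥
    too-short zero          _ w = a≢z (sym (walk0 w))
    too-short (suc zero)    _ w = proper z a (walk1 w) (sym ca)
    too-short (suc (suc k)) (s≤s ()) w

  near : ∀ {z y} → ε z ≤ 2 → c y ≢ c z → Adj G z y
  near {z} {y} εz≤2 cy≢cz with reach z y
  ... | (k , k≤ε , w) = short-walk-adj w (ℕP.≤-trans k≤ε εz≤2) (λ e → cy≢cz (sym e))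

  private
    other-colour : ∀ {a} b → c a ≡ not b → c a ≢ b
    other-colour b ca e = BP.not-¬ refl (trans (sym e) ca)

  -- Central vertices (eccentricity ≤ 2) of an acyclic graph are pairwise adjacent:
  -- two of the same colour would both be adjacent to two vertices of the other colour.
  central-adjacent : ¬ HasCycle G → ∀ {u v} → ε u ≤ 2 → ε v ≤ 2 → u ≢ v → Adj G u v
  central-adjacent acyc {u} {v} εu εv u≢v with c u BP.≟ c v
  ... | no cu≢cv = near εu (λ e → cu≢cv (sym e))
  ... | yes cu≡cv with classes (not (c u)) u
  ... | (a₁ , _ , ca₁) with classes (not (c u)) a₁
  ... | (a₂ , a₂≢a₁ , ca₂) = ⊥-elim (acyc (square (near εu (other-colour _ ca₁))
          (Graph.sym G (near εv (other-colour _ (trans ca₁ (cong not cu≡cv)))))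
          (near εv (other-colour _ (trans ca₂ (cong not cu≡cv))))
          (Graph.sym G (near εu (other-colour _ ca₂)))
          u≢v (λ e → a₂≢a₁ (sym e))))

  central : Fin n → Bool
  central z = ε z ℕ.≤ᵇ 2

  central-sound : ∀ {z} → central z ≡ true → ε z ≤ 2
  central-sound {z} e = ℕP.≤ᵇ⇒≤ (ε z) 2 (subst T (sym e) tt)

  central-complete : ∀ {z} → ε z ≤ 2 → central z ≡ true
  central-complete {z} εz≤2 with central z | ℕP.≤ᵇ-reflects-≤ (ε z) 2
  ... | true  | _        = refl
  ... | false | ofⁿ ε≰2 = ⊥-elim (ε≰2 εz≤2)

  centralNbrs : Fin n → ℕ
  centralNbrs w = count (λ z → central z ∧ adj z w)

  private
    central-nbr : ∀ {z w} → (central z ∧ adj z w) ≡ true → ε z ≤ 2 × Adj G z w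
    central-nbr {z} {w} e with central z in ez
    ... | true = central-sound ez , adj-sound e

  -- No vertex has two central neighbours: they would form a triangle with it.
  centralNbrs-≤1 : ¬ HasCycle G → ∀ w → centralNbrs w ≤ 1
  centralNbrs-≤1 acyc w = count-≤1 _ λ z₁ z₂ e₁ e₂ → case z₁ FP.≟ z₂ of λ where
    (yes eq)    → eq
    (no z₁≢z₂) → let (ε₁ , a₁) = central-nbr e₁ ; (ε₂ , a₂) = central-nbr e₂ in
                  ⊥-elim (no-triangle (central-adjacent acyc ε₁ ε₂ z₁≢z₂) a₂ a₁)

  -- If every vertex has a central neighbour, two adjacent central vertices dominate G.
  dominating-edge : ¬ HasCycle G → Fin n → (∀ w → 1 ≤ centralNbrs w) → DominatingEdge G
  dominating-edge acyc w₀ all-nbr = r , x , Graph.sym G ax , covered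
    where
    nbr : ∀ w → Σ (Fin n) λ z → ε z ≤ 2 × Adj G z w
    nbr w = let (z , e) = count-witness _ (all-nbr w) in z , central-nbr e
    r : Fin n
    r = proj₁ (nbr w₀)
    x : Fin n
    x = proj₁ (nbr r)
    εr : ε r ≤ 2
    εr = proj₁ (proj₂ (nbr w₀))
    εx : ε x ≤ 2
    εx = proj₁ (proj₂ (nbr r))
    ax : Adj G x r
    ax = proj₂ (proj₂ (nbr r))
    covered : ∀ z → Adj G r z ⊎ Adj G x z
    covered z with nbr z
    ... | (y , εy , ayz) with y FP.≟ r | y FP.≟ x
    ...   | yes refl | _        = inj₁ ayz
    ...   | no _     | yes refl = inj₂ ayz
    ...   | no y≢r   | no y≢x   = ⊥-elim (no-triangle (central-adjacent acyc εy εr y≢r) (Graph.sym G ax)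
                                          (central-adjacent acyc εy εx y≢x))

  module AroundDominatingEdge (r x : Fin n) (arx : Adj G r x) (cover : ∀ z → Adj G r z ⊎ Adj G x z) where
    ecc-≤3 : ∀ z → ε z ≤ 3
    ecc-≤3 z = ecc-≤ (ecc z) walk-≤3
      where
      walk-≤3 : ∀ y → Σ ℕ λ k → k ≤ 3 × Walk G z y k
      walk-≤3 y with cover z | cover y
      ... | inj₁ rz | inj₁ ry = 2 , s≤s (s≤s z≤n) , cons (Graph.sym G rz) (cons ry nil)
      ... | inj₁ rz | inj₂ xy = 3 , ℕP.≤-refl , cons (Graph.sym G rz) (cons arx (cons xy nil))
      ... | inj₂ xz | inj₁ ry = 3 , ℕP.≤-refl , cons (Graph.sym G xz) (cons (Graph.sym G arx) (cons ry nil))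
      ... | inj₂ xz | inj₂ xy = 2 , s≤s (s≤s z≤n) , cons (Graph.sym G xz) (cons xy nil)

    ecc-r : ε r ≤ 2
    ecc-r = ecc-≤ (ecc r) λ y → case cover y of λ where
      (inj₁ ry) → 1 , s≤s z≤n , cons ry nil
      (inj₂ xy) → 2 , ℕP.≤-refl , cons arx (cons xy nil)

    ecc-x : ε x ≤ 2
    ecc-x = ecc-≤ (ecc x) λ y → case cover y of λ where
      (inj₁ ry) → 2 , ℕP.≤-refl , cons (Graph.sym G arx) (cons ry nil)
      (inj₂ xy) → 1 , s≤s z≤n , cons xy nil

    every-centralNbr : ∀ w → 1 ≤ centralNbrs w
    every-centralNbr w with cover w
    ... | inj₁ rw = count-≥1 _ r (cong₂ _∧_ (central-complete ecc-r) (adj-true rw))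
    ... | inj₂ xw = count-≥1 _ x (cong₂ _∧_ (central-complete ecc-x) (adj-true xw))

  totalWeight : ℕ
  totalWeight = sumN (λ z → weight (degree G z) (ε z))

  xi-≤ : xiEE G ε ℚ.≤ frac totalWeight 5
  xi-≤ = ℚP.≤-trans (sumℚ-mono (λ z → weight-bound (degree G z) (ε z) (ecc-≥2 z)))
                    (ℚP.≤-reflexive (sumℚ-frac (λ z → weight (degree G z) (ε z)) 5))

  xi-≡ : (∀ z → ε z ≤ 3) → xiEE G ε ≡ frac totalWeight 5
  xi-≡ ε≤3 = trans (sumℚ-cong (λ z → weight-exact (degree G z) (ε z) (ecc-≥2 z) (ε≤3 z))) (sumℚ-frac (λ z → weight (degree G z) (ε z)) 5)

  -- The extra weight of the central vertices is the number of edges at central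
  -- vertices, counted from their other ends.
  totalWeight-split : totalWeight ≡ sumN (degree G) + sumN (degree G) + sumN centralNbrs
  totalWeight-split = begin
    totalWeight
      ≡⟨ sumN-cong (λ z → cong₂ _+_ (double (degree G z)) (central-degree z)) ⟩
    sumN (λ z → (degree G z + degree G z) + count (λ w → central z ∧ adj z w))
      ≡⟨ sumN-+ (λ z → degree G z + degree G z) (λ z → count (λ w → central z ∧ adj z w)) ⟩
    sumN (λ z → degree G z + degree G z) + sumN (λ z → count (λ w → central z ∧ adj z w))
      ≡⟨ cong₂ _+_ (sumN-+ (degree G) (degree G)) central-edges ⟩
    sumN (degree G) + sumN (degree G) + sumN centralNbrs ∎
    where
    open ≡-Reasoning
    double : ∀ d → 2 * d ≡ d + d
    double = solve-∀
    central-degree : ∀ z → (if central z then degree G z else 0) ≡ count (λ w → central z ∧ adj z w)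
    central-degree z with central z
    ... | true  = refl
    ... | false = sym (count-none {n} (λ _ → false) (λ _ → refl))
    central-edges : sumN (λ z → count (λ w → central z ∧ adj z w)) ≡ sumN centralNbrs
    central-edges = trans (sumN-cong (λ z → count-sum (λ w → central z ∧ adj z w)))
      (trans (sumN-swap (λ z w → indicator (central z ∧ adj z w)))
             (sym (sumN-cong (λ w → count-sum (λ z → central z ∧ adj z w)))))

-- A vertex of P₂(a,b) seen from its colour class: inj₂ zero is the centre x,
-- inj₁ zero the centre y, the other inj₁ i the leaves at x, the other inj₂ j the
-- leaves at y.
Sides : ℕ → ℕ → Set
Sides a b = Fin (suc a) ⊎ Fin (suc b)

data SideEdge {a b : ℕ} : Sides a b → Sides a b → Set where
  at-x : ∀ i → SideEdge (inj₂ F.zero) (inj₁ i)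
  at-y : ∀ j → SideEdge (inj₁ F.zero) (inj₂ (F.suc j))

module Numbering (a b : ℕ) where

  -- The numbering used by P2: x ↦ 0, y ↦ 1, leaves at x ↦ 2…a+1, leaves at y ↦ a+2….
  number : Sides a b → Fin (suc (suc (a + b)))
  number (inj₁ i)         = F.suc (i F.↑ˡ b)
  number (inj₂ F.zero)    = F.zero
  number (inj₂ (F.suc j)) = F.suc (suc a F.↑ʳ j)

  unnumber : Fin (suc (suc (a + b))) → Sides a b
  unnumber F.zero    = inj₂ F.zero
  unnumber (F.suc k) = Sum.map₂ F.suc (F.splitAt (suc a) k)

  numbering : Sides a b ↔ Fin (suc (suc (a + b)))
  numbering = mk↔ₛ′ number unnumber number-unnumber unnumber-number
    where
    number-unnumber : ∀ k → number (unnumber k) ≡ k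
    number-unnumber F.zero    = refl
    number-unnumber (F.suc k) with F.splitAt (suc a) k | FP.join-splitAt (suc a) b k
    ... | inj₁ i | e = cong F.suc e
    ... | inj₂ j | e = cong F.suc e
    unnumber-number : ∀ s → unnumber (number s) ≡ s
    unnumber-number (inj₁ i) rewrite FP.splitAt-↑ˡ (suc a) i b = refl
    unnumber-number (inj₂ F.zero) = refl
    unnumber-number (inj₂ (F.suc j)) rewrite FP.splitAt-↑ʳ (suc a) b j = refl

  position : Sides a b → ℕ
  position (inj₁ i)         = suc (toℕ i)
  position (inj₂ F.zero)    = 0
  position (inj₂ (F.suc j)) = suc (suc (a + toℕ j))

  toℕ-number : ∀ s → toℕ (number s) ≡ position s
  toℕ-number (inj₁ i)         = cong suc (FP.toℕ-↑ˡ i b)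
  toℕ-number (inj₂ F.zero)    = refl
  toℕ-number (inj₂ (F.suc j)) = cong suc (FP.toℕ-↑ʳ (suc a) j)

  private
    edge→side : ∀ s t → P2Edge a (position s) (position t) → SideEdge s t
    edge→side (inj₂ F.zero) (inj₁ i) _ = at-x i
    edge→side (inj₁ F.zero) (inj₂ (F.suc j)) _ = at-y j
    edge→side (inj₂ F.zero) (inj₂ F.zero) (inj₁ (_ , ()))
    edge→side (inj₂ F.zero) (inj₂ F.zero) (inj₂ (inj₁ (_ , () , _)))
    edge→side (inj₂ F.zero) (inj₂ F.zero) (inj₂ (inj₂ (() , _)))
    edge→side (inj₂ F.zero) (inj₂ (F.suc j)) (inj₁ (_ , ()))
    edge→side (inj₂ F.zero) (inj₂ (F.suc j)) (inj₂ (inj₁ (_ , _ , s≤s (s≤s l)))) =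
      ⊥-elim (ℕP.n≮n a (ℕP.≤-<-trans (ℕP.m≤m+n a (toℕ j)) l))
    edge→side (inj₂ F.zero) (inj₂ (F.suc j)) (inj₂ (inj₂ (() , _)))
    edge→side (inj₁ F.zero) (inj₁ i) (inj₂ (inj₂ (_ , s≤s l))) =
      ⊥-elim (ℕP.n≮n (toℕ i) (ℕP.<-≤-trans (FP.toℕ<n i) l))
    edge→side (inj₁ F.zero) (inj₂ F.zero) (inj₂ (inj₂ (_ , ())))
    edge→side (inj₁ F.zero) _ (inj₁ (() , _))
    edge→side (inj₁ F.zero) _ (inj₂ (inj₁ (() , _)))
    edge→side (inj₁ (F.suc i)) _ (inj₁ (() , _))
    edge→side (inj₁ (F.suc i)) _ (inj₂ (inj₁ (() , _)))
    edge→side (inj₁ (F.suc i)) _ (inj₂ (inj₂ (() , _)))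
    edge→side (inj₂ (F.suc j)) _ (inj₁ (() , _))
    edge→side (inj₂ (F.suc j)) _ (inj₂ (inj₁ (() , _)))
    edge→side (inj₂ (F.suc j)) _ (inj₂ (inj₂ (() , _)))

    side→edge : ∀ {s t} → SideEdge s t → P2Edge a (position s) (position t)
    side→edge (at-x F.zero)    = inj₁ (refl , refl)
    side→edge (at-x (F.suc i)) = inj₂ (inj₁ (refl , s≤s (s≤s z≤n) , s≤s (s≤s (FP.toℕ<n i))))
    side→edge (at-y j)         = inj₂ (inj₂ (refl , s≤s (s≤s (ℕP.m≤m+n a (toℕ j)))))

    edge-number : ∀ s t → P2Edge a (toℕ (number s)) (toℕ (number t)) ≡ P2Edge a (position s) (position t)
    edge-number s t = cong₂ (P2Edge a) (toℕ-number s) (toℕ-number t)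

  P2Adj→side : ∀ s t → P2Adj a b (number s) (number t) → SideEdge s t ⊎ SideEdge t s
  P2Adj→side s t (inj₁ e) = inj₁ (edge→side s t (subst id (edge-number s t) e))
  P2Adj→side s t (inj₂ e) = inj₂ (edge→side t s (subst id (edge-number t s) e))

  side→P2Adj : ∀ s t → SideEdge s t ⊎ SideEdge t s → P2Adj a b (number s) (number t)
  side→P2Adj s t (inj₁ e) = inj₁ (subst id (sym (edge-number s t)) (side→edge e))
  side→P2Adj s t (inj₂ e) = inj₂ (subst id (sym (edge-number t s)) (side→edge e))

module Partition where
  split : ∀ {m} (f : Fin m → Bool) → Fin m → Fin (count (λ i → not (f i))) ⊎ Fin (count f)
  split {suc m} f i with f F.zero
  split {suc m} f F.zero    | true  = inj₂ F.zero
  split {suc m} f (F.suc i) | true  = Sum.map₂ F.suc (split (λ k → f (F.suc k)) i)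
  split {suc m} f F.zero    | false = inj₁ F.zero
  split {suc m} f (F.suc i) | false = Sum.map₁ F.suc (split (λ k → f (F.suc k)) i)

  merge : ∀ {m} (f : Fin m → Bool) → Fin (count (λ i → not (f i))) ⊎ Fin (count f) → Fin m
  merge {zero}  f (inj₁ ())
  merge {zero}  f (inj₂ ())
  merge {suc m} f s with f F.zero
  merge {suc m} f (inj₂ F.zero)    | true  = F.zero
  merge {suc m} f (inj₂ (F.suc j)) | true  = F.suc (merge (λ k → f (F.suc k)) (inj₂ j))
  merge {suc m} f (inj₁ i)         | true  = F.suc (merge (λ k → f (F.suc k)) (inj₁ i))
  merge {suc m} f (inj₁ F.zero)    | false = F.zero
  merge {suc m} f (inj₁ (F.suc i)) | false = F.suc (merge (λ k → f (F.suc k)) (inj₁ i))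
  merge {suc m} f (inj₂ j)         | false = F.suc (merge (λ k → f (F.suc k)) (inj₂ j))

  merge-split : ∀ {m} (f : Fin m → Bool) i → merge f (split f i) ≡ i
  merge-split {suc m} f i with f F.zero
  merge-split {suc m} f F.zero | true = refl
  merge-split {suc m} f (F.suc i) | true
    with split (λ k → f (F.suc k)) i | merge-split (λ k → f (F.suc k)) i
  ... | inj₁ _ | e = cong F.suc e
  ... | inj₂ _ | e = cong F.suc e
  merge-split {suc m} f F.zero | false = refl
  merge-split {suc m} f (F.suc i) | false
    with split (λ k → f (F.suc k)) i | merge-split (λ k → f (F.suc k)) i
  ... | inj₁ _ | e = cong F.suc e
  ... | inj₂ _ | e = cong F.suc e

  split-merge : ∀ {m} (f : Fin m → Bool) s → split f (merge f s) ≡ s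
  split-merge {zero}  f (inj₁ ())
  split-merge {zero}  f (inj₂ ())
  split-merge {suc m} f s with f F.zero
  split-merge {suc m} f (inj₂ F.zero)    | true  = refl
  split-merge {suc m} f (inj₂ (F.suc j)) | true  = cong (Sum.map₂ F.suc) (split-merge (λ k → f (F.suc k)) (inj₂ j))
  split-merge {suc m} f (inj₁ i)         | true  = cong (Sum.map₂ F.suc) (split-merge (λ k → f (F.suc k)) (inj₁ i))
  split-merge {suc m} f (inj₁ F.zero)    | false = refl
  split-merge {suc m} f (inj₁ (F.suc i)) | false = cong (Sum.map₁ F.suc) (split-merge (λ k → f (F.suc k)) (inj₁ i))
  split-merge {suc m} f (inj₂ j)         | false = cong (Sum.map₁ F.suc) (split-merge (λ k → f (F.suc k)) (inj₂ j))

  partition : ∀ {m} (f : Fin m → Bool) → Fin m ↔ (Fin (count (λ i → not (f i))) ⊎ Fin (count f))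
  partition f = mk↔ₛ′ (split f) (merge f) (split-merge f) (merge-split f)

  split-false : ∀ {m} (f : Fin m → Bool) i → f i ≡ false → Σ _ λ k → split f i ≡ inj₁ k
  split-false {suc m} f i e with f F.zero in e₀
  split-false {suc m} f F.zero    e | true = ⊥-elim (BP.not-¬ refl (trans (sym e₀) e))
  split-false {suc m} f (F.suc i) e | true =
    let (k , eq) = split-false (λ k → f (F.suc k)) i e in k , cong (Sum.map₂ F.suc) eq
  split-false {suc m} f F.zero    e | false = F.zero , refl
  split-false {suc m} f (F.suc i) e | false =
    let (k , eq) = split-false (λ k → f (F.suc k)) i e in F.suc k , cong (Sum.map₁ F.suc) eq

  split-true : ∀ {m} (f : Fin m → Bool) i → f i ≡ true → Σ _ λ k → split f i ≡ inj₂ k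
  split-true {suc m} f i e with f F.zero in e₀
  split-true {suc m} f F.zero    e | true = F.zero , refl
  split-true {suc m} f (F.suc i) e | true =
    let (k , eq) = split-true (λ k → f (F.suc k)) i e in F.suc k , cong (Sum.map₂ F.suc) eq
  split-true {suc m} f F.zero    e | false = ⊥-elim (BP.not-¬ refl (trans (sym e) e₀))
  split-true {suc m} f (F.suc i) e | false =
    let (k , eq) = split-true (λ k → f (F.suc k)) i e in k , cong (Sum.map₁ F.suc) eq

_⊎-↔_ : ∀ {A B C D : Set} → A ↔ B → C ↔ D → (A ⊎ C) ↔ (B ⊎ D)
f ⊎-↔ g = mk↔ₛ′ (Sum.map (Inverse.to f) (Inverse.to g)) (Sum.map (Inverse.from f) (Inverse.from g))
  (λ { (inj₁ b) → cong inj₁ (Inverse.strictlyInverseˡ f b) ; (inj₂ d) → cong inj₂ (Inverse.strictlyInverseˡ g d) })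
  (λ { (inj₁ a) → cong inj₁ (Inverse.strictlyInverseʳ f a) ; (inj₂ c) → cong inj₂ (Inverse.strictlyInverseʳ g c) })

to-zero : ∀ {m a} → m ≡ suc a → (k : Fin m) → Σ (Permutation m (suc a)) λ π → π ⟨$⟩ʳ k ≡ F.zero
to-zero e k = cast-id e ∘ₚ transpose (F.cast e k) F.zero , transposes (F.cast e k) F.zero
  where
  transposes : ∀ {n} (i j : Fin n) → PC.transpose i j i ≡ j
  transposes i j rewrite dec-true (i FP.≟ i) refl = refl

module DoubleStar {n} (G : Graph n) (c : Fin n → Bool) (proper : ∀ x y → Adj G x y → c x ≢ c y)
                  (acyc : ¬ HasCycle G) (a b : ℕ)
                  (size-false : count (λ i → not (c i)) ≡ suc a) (size-true : count c ≡ suc b)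
                  (R X : Fin n) (aRX : Adj G R X) (cover : ∀ z → Adj G R z ⊎ Adj G X z)
                  (cR : c R ≡ true) where
  open Basics G
  open Colouring G c proper
  open Partition
  open Numbering a b

  cX : c X ≡ false
  cX = trans (adj-flip aRX) (cong not cR)

  -- Every edge has R or X as an endpoint: otherwise it closes a triangle or a square.
  edge-at-centre : ∀ {u v} → Adj G u v → (u ≡ R ⊎ u ≡ X) ⊎ (v ≡ R ⊎ v ≡ X)
  edge-at-centre {u} {v} uv with u FP.≟ R | u FP.≟ X | v FP.≟ R | v FP.≟ X
  ... | yes u≡R | _       | _       | _       = inj₁ (inj₁ u≡R)
  ... | no _    | yes u≡X | _       | _       = inj₁ (inj₂ u≡X)
  ... | no _    | no _    | yes v≡R | _       = inj₂ (inj₁ v≡R)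
  ... | no _    | no _    | no _    | yes v≡X = inj₂ (inj₂ v≡X)
  ... | no u≢R  | no u≢X  | no v≢R  | no v≢X  = ⊥-elim (case cover u , cover v of λ where
    (inj₁ Ru , inj₁ Rv) → no-triangle Ru uv Rv
    (inj₂ Xu , inj₂ Xv) → no-triangle Xu uv Xv
    (inj₁ Ru , inj₂ Xv) → acyc (square Ru uv (Graph.sym G Xv) (Graph.sym G aRX) (λ e → v≢R (sym e)) u≢X)
    (inj₂ Xu , inj₁ Rv) → acyc (square Rv (Graph.sym G uv) (Graph.sym G Xu) (Graph.sym G aRX) (λ e → u≢R (sym e)) v≢X))

  private
    πX : Σ (Permutation (count (λ i → not (c i))) (suc a)) λ π → π ⟨$⟩ʳ proj₁ (split-false c X cX) ≡ F.zero
    πX = to-zero size-false (proj₁ (split-false c X cX))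
    πR : Σ (Permutation (count c) (suc b)) λ π → π ⟨$⟩ʳ proj₁ (split-true c R cR) ≡ F.zero
    πR = to-zero size-true (proj₁ (split-true c R cR))

  sorting : Fin n ↔ Sides a b
  sorting = (proj₁ πX ⊎-↔ proj₁ πR) ↔-∘ partition c

  sort : Fin n → Sides a b
  sort = Inverse.to sorting

  sort-X : sort X ≡ inj₁ F.zero
  sort-X = trans (cong (Sum.map (proj₁ πX ⟨$⟩ʳ_) (proj₁ πR ⟨$⟩ʳ_)) (proj₂ (split-false c X cX)))
                 (cong inj₁ (proj₂ πX))

  sort-R : sort R ≡ inj₂ F.zero
  sort-R = trans (cong (Sum.map (proj₁ πX ⟨$⟩ʳ_) (proj₁ πR ⟨$⟩ʳ_)) (proj₂ (split-true c R cR)))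
                 (cong inj₂ (proj₂ πR))

  sort-injective : ∀ {u v} → sort u ≡ sort v → u ≡ v
  sort-injective {u} {v} e = trans (sym (Inverse.strictlyInverseʳ sorting u))
    (trans (cong (Inverse.from sorting) e) (Inverse.strictlyInverseʳ sorting v))

  sort-false : ∀ {u} → c u ≡ false → Σ (Fin (suc a)) λ i → sort u ≡ inj₁ i
  sort-false {u} e = let (k , eq) = split-false c u e in
    proj₁ πX ⟨$⟩ʳ k , cong (Sum.map (proj₁ πX ⟨$⟩ʳ_) (proj₁ πR ⟨$⟩ʳ_)) eq

  sort-true : ∀ {u} → c u ≡ true → Σ (Fin (suc b)) λ j → sort u ≡ inj₂ j
  sort-true {u} e = let (k , eq) = split-true c u e in
    proj₁ πR ⟨$⟩ʳ k , cong (Sum.map (proj₁ πX ⟨$⟩ʳ_) (proj₁ πR ⟨$⟩ʳ_)) eq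

  left-class : ∀ {u i} → sort u ≡ inj₁ i → c u ≡ false
  left-class {u} e with c u in cu
  ... | false = refl
  ... | true  = case trans (sym e) (proj₂ (sort-true cu)) of λ ()

  right-class : ∀ {u j} → sort u ≡ inj₂ j → c u ≡ true
  right-class {u} e with c u in cu
  ... | true  = refl
  ... | false = case trans (sym e) (proj₂ (sort-false cu)) of λ ()

  private
    from-R : ∀ {v} → Adj G R v → SideEdge (sort R) (sort v)
    from-R {v} Rv with sort-false {v} (trans (adj-flip Rv) (cong not cR))
    ... | (i , e) rewrite sort-R | e = at-x i

    from-X : ∀ {v} → Adj G X v → v ≢ R → SideEdge (sort X) (sort v)
    from-X {v} Xv v≢R with sort-true {v} (trans (adj-flip Xv) (cong not cX))
    ... | (F.zero , e)  = ⊥-elim (v≢R (sort-injective (trans e (sym sort-R))))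
    ... | (F.suc j , e) rewrite sort-X | e = at-y j

  adj→side : ∀ {u v} → Adj G u v → SideEdge (sort u) (sort v) ⊎ SideEdge (sort v) (sort u)
  adj→side {u} {v} uv with u FP.≟ R | v FP.≟ R
  ... | yes refl | _        = inj₁ (from-R uv)
  ... | no _     | yes refl = inj₂ (from-R (Graph.sym G uv))
  ... | no u≢R   | no v≢R with edge-at-centre uv
  ...   | inj₁ (inj₁ u≡R)  = ⊥-elim (u≢R u≡R)
  ...   | inj₁ (inj₂ refl) = inj₁ (from-X uv v≢R)
  ...   | inj₂ (inj₁ v≡R)  = ⊥-elim (v≢R v≡R)
  ...   | inj₂ (inj₂ refl) = inj₂ (from-X (Graph.sym G uv) u≢R)

  side→adj : ∀ {s t} → SideEdge s t → ∀ {u v} → sort u ≡ s → sort v ≡ t → Adj G u v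
  side→adj (at-x i) {u} {v} eu ev with sort-injective (trans eu (sym sort-R)) | cover v
  ... | refl | inj₁ Rv = Rv
  ... | refl | inj₂ Xv = ⊥-elim (proper X v Xv (trans cX (sym (left-class ev))))
  side→adj (at-y j) {u} {v} eu ev with sort-injective (trans eu (sym sort-X)) | cover v
  ... | refl | inj₂ Xv = Xv
  ... | refl | inj₁ Rv = ⊥-elim (proper R v Rv (trans cR (sym (right-class ev))))

  double-star : G ≅ P2 a b
  double-star = record
    { bij  = numbering ↔-∘ sorting
    ; pres = λ u v → (λ uv → side→P2Adj (sort u) (sort v) (adj→side uv))
                   , (λ p → case P2Adj→side (sort u) (sort v) p of λ where
                        (inj₁ e) → side→adj e refl refl
                        (inj₂ e) → Graph.sym G (side→adj e refl refl))
    }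

P2-dominating : ∀ a b → DominatingEdge (P2 a b)
P2-dominating a b = F.zero , F.suc F.zero , inj₁ (inj₁ (refl , refl)) , cover
  where
  cover : ∀ i → P2Adj a b F.zero i ⊎ P2Adj a b (F.suc F.zero) i
  cover F.zero           = inj₂ (inj₂ (inj₁ (refl , refl)))
  cover (F.suc F.zero)   = inj₁ (inj₁ (inj₁ (refl , refl)))
  cover (F.suc (F.suc j)) with toℕ j ℕP.<? a
  ... | yes j<a = inj₁ (inj₁ (inj₂ (inj₁ (refl , s≤s (s≤s z≤n) , s≤s (s≤s j<a)))))
  ... | no j≮a  = inj₂ (inj₁ (inj₂ (inj₂ (refl , s≤s (s≤s (ℕP.≮⇒≥ j≮a))))))

dominating-transfer : ∀ {n m} {G : Graph n} {H : Graph m} → G ≅ H → DominatingEdge H → DominatingEdge G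
dominating-transfer {n} {m} {G} {H} iso (r , x , rx , cover) = from r , from x , reflect rx , cover′
  where
  open _≅_ iso
  to : Fin n → Fin m
  to = Inverse.to bij
  from : Fin m → Fin n
  from = Inverse.from bij
  reflect : ∀ {y z} → Adj H y z → Adj G (from y) (from z)
  reflect {y} {z} yz = proj₂ (pres (from y) (from z))
    (subst₂ (Adj H) (sym (Inverse.strictlyInverseˡ bij y)) (sym (Inverse.strictlyInverseˡ bij z)) yz)
  cover′ : ∀ z → Adj G (from r) z ⊎ Adj G (from x) z
  cover′ z = Sum.map (λ e → subst (Adj G (from r)) (Inverse.strictlyInverseʳ bij z) (reflect e))
                     (λ e → subst (Adj G (from x)) (Inverse.strictlyInverseʳ bij z) (reflect e))
                     (cover (to z))

module Extremal (p q : ℕ) (2<p : 2 < p) (p≤q : p ≤ q) (T : Graph (p + q)) (tree : IsTree T)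
                (bip : HasBipartition T p q) (ε : Fin (p + q) → ℕ)
                (ecc : ∀ x → IsEccentricity T x (ε x)) where
  n : ℕ
  n = p + q

  c : Fin n → Bool
  c = proj₁ bip

  size-false : count (λ i → not (c i)) ≡ p
  size-false = proj₁ (proj₂ bip)

  size-true : count c ≡ q
  size-true = proj₁ (proj₂ (proj₂ bip))

  proper : ∀ x y → Adj T x y → c x ≢ c y
  proper = proj₂ (proj₂ (proj₂ bip))

  acyc : ¬ HasCycle T
  acyc = proj₂ tree

  private
    2≤p : 2 ≤ p
    2≤p = ℕP.<⇒≤ 2<p

    2≤q : 2 ≤ q
    2≤q = ℕP.≤-trans 2≤p p≤q

    suc-∸1 : ∀ {m} → 2 ≤ m → suc (m ∸ 1) ≡ m
    suc-∸1 (s≤s _) = refl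

    size-false′ : count (λ i → not (c i)) ≡ suc (p ∸ 1)
    size-false′ = trans size-false (sym (suc-∸1 2≤p))

    size-true′ : count c ≡ suc (q ∸ 1)
    size-true′ = trans size-true (sym (suc-∸1 2≤q))

  classes : ∀ b u → Σ (Fin n) λ a → a ≢ u × c a ≡ b
  classes true u  = count-witness-≢ c (subst (2 ≤_) (sym size-true) 2≤q) u
  classes false u =
    let (a , a≢u , e) = count-witness-≢ (λ i → not (c i)) (subst (2 ≤_) (sym size-false) 2≤p) u
    in a , a≢u , BP.not-injective e

  root : Fin n
  root = proj₁ (count-witness c (subst (1 ≤_) (sym size-true) (ℕP.≤-trans (s≤s z≤n) 2≤q)))

  open Eccentricities T c proper classes ε ecc

  E : ℕ
  E = sumN centralNbrs

  E≤n : E ≤ n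
  E≤n = sumN-≤1 centralNbrs (centralNbrs-≤1 acyc)

  weight-budget : totalWeight + n ≡ 5 * n ∸ 4 + E
  weight-budget = trans (cong (_+ n) totalWeight-split)
    (budget E (tree-degree-sum T c proper tree root))

  xi-bound : xiEE T ε ℚ.≤ frac (5 * n ∸ 4) 5
  xi-bound = ℚP.≤-trans xi-≤ (frac-≤ {totalWeight} {5 * n ∸ 4} {5} {5} (ℕP.*-monoˡ-≤ 6 weight≤))
    where
    weight≤ : totalWeight ≤ 5 * n ∸ 4
    weight≤ = ℕP.+-cancelʳ-≤ n _ _
      (ℕP.≤-trans (ℕP.≤-reflexive weight-budget) (ℕP.+-monoʳ-≤ (5 * n ∸ 4) E≤n))

  -- Equality forces every vertex to have a central neighbour, hence a dominating edge.
  equality⇒dominating : xiEE T ε ≡ frac (5 * n ∸ 4) 5 → DominatingEdge T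
  equality⇒dominating eq = dominating-edge acyc root (sumN-full centralNbrs (centralNbrs-≤1 acyc) n≤E)
    where
    bound≤weight : 5 * n ∸ 4 ≤ totalWeight
    bound≤weight = ℕP.*-cancelʳ-≤ _ _ 6 (frac-≤⁻ {5 * n ∸ 4} {totalWeight} {5} {5} (subst (ℚ._≤ frac totalWeight 5) eq xi-≤))
    n≤E : n ≤ E
    n≤E = ℕP.+-cancelˡ-≤ (5 * n ∸ 4) n E
      (ℕP.≤-trans (ℕP.+-monoˡ-≤ n bound≤weight) (ℕP.≤-reflexive weight-budget))

  -- Around a dominating edge all eccentricities are 2 or 3 and E = n, so equality holds.
  dominating⇒equality : DominatingEdge T → xiEE T ε ≡ frac (5 * n ∸ 4) 5
  dominating⇒equality (r , x , rx , cover) = trans (xi-≡ ecc-≤3) (cong (λ w → frac w 5) weight≡)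
    where
    open AroundDominatingEdge r x rx cover
    E≡n : E ≡ n
    E≡n = ℕP.≤-antisym E≤n (sumN-≥1 centralNbrs every-centralNbr)
    weight≡ : totalWeight ≡ 5 * n ∸ 4
    weight≡ = ℕP.+-cancelʳ-≡ n _ _ (trans weight-budget (cong (λ e → 5 * n ∸ 4 + e) E≡n))

  dominating⇒double-star : DominatingEdge T → T ≅ P2 (p ∸ 1) (q ∸ 1)
  dominating⇒double-star (r , x , rx , cover) with c r in cr
  ... | true  = DoubleStar.double-star T c proper acyc (p ∸ 1) (q ∸ 1) size-false′ size-true′ r x rx cover cr
  ... | false = DoubleStar.double-star T c proper acyc (p ∸ 1) (q ∸ 1) size-false′ size-true′
                  x r (Graph.sym T rx) (λ z → Sum.swap (cover z)) (trans (adj-flip rx) (cong not cr))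
    where open Colouring T c proper

theorem4p6 : (p q : ℕ) → 2 < p → p ≤ q →
    (T : Graph (p + q)) → IsTree T → HasBipartition T p q →
    (ε : Fin (p + q) → ℕ) → (∀ x → IsEccentricity T x (ε x)) →
    (xiEE T ε ℚ.≤ (+ (5 * (p + q) ∸ 4)) / 6)
    × ((xiEE T ε ≡ (+ (5 * (p + q) ∸ 4)) / 6) ⇔ (T ≅ P2 (p ∸ 1) (q ∸ 1)))
theorem4p6 p q 2<p p≤q T tree bip ε ecc =
  xi-bound ,
  mk⇔ (λ equal → dominating⇒double-star (equality⇒dominating equal))
      (λ iso → dominating⇒equality (dominating-transfer iso (P2-dominating (p ∸ 1) (q ∸ 1))))
  where open Extremal p q 2<p p≤q T tree bip ε ecc
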